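{- Let $(M,\preceq,\oplus,0)$ be an ordered partial commutative monoid which is $\oplus$-downward closed, i.e. if $x\preceq x'$ and $x'\perp y$ then $x\perp y$. Let $\mathbb{P}^+M$ be the set of non-empty subsets of $M$. For $P,Q\in\mathbb{P}^+M$ define \[P\boldsymbol{\oplus}Q:=\{x\oplus y: x\in P,\ y\in Q,\ x\perp y\},\] defined exactly when this set is non-empty, and $P\preceq^\sharp Q$ iff for every $y\in Q$ there is $x\in P$ with $x\preceq y$. Then (1) $(\mathbb{P}^+M,\preceq^\sharp,\boldsymbol{\oplus},\{0\})$ is an ordered partial commutative monoid; (2) if $0\preceq x$ for every $x\in M$, then $\{0\}\preceq^\sharp P$ for every $P\in\mathbb{P}^+M$.
   Context: An ordered partial commutative monoid (OPCM) $(M,\preceq,\oplus,0)$ consists of a preorder $\preceq$ on a set $M$, an element $0\in M$, and a partial binary operation $\oplus$ on $M$. Write $x\perp y$ when $x\oplus y$ is defined, and $x\cong y$ when $x\preceq y$ and $y\preceq x$. The axioms are: (OPCM1) $0\oplus x$ is defined and $0\oplus x\cong x$; (OPCM2) if $x\perp y$ then $y\perp x$ and $x\oplus y\cong y\oplus x$; (OPCM3) if $y\perp z$ and $x\perp(y\oplus z)$ then $x\perp y$, $(x\oplus y)\perp z$ and $x\oplus(y\oplus z)\cong(x\oplus y)\oplus z$; (OPCM4) if $x_1\preceq x_2$, $x_1\perp y$ and $x_2\perp y$ then $x_1\oplus y\preceq x_2\oplus y$. -}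

module Defs where

open import Level using (Level; _⊔_; suc; Lift)
open import Data.Product using (Σ; Σ-syntax; _×_; _,_)
open import Relation.Binary.PropositionalEquality using (_≡_)

-- The partial operation ⊕ is given by a definedness relation _⊥_
-- ("x ⊥ y" = "x ⊕ y is defined") together with a total operation on
-- pairs equipped with a proof of definedness.
record IsOPCM {c ℓ : Level} (M : Set c)
              (_≼_ : M → M → Set ℓ)
              (_⊥_ : M → M → Set ℓ)
              (_⊕_ : (x y : M) → x ⊥ y → M)
              (𝟘 : M) : Set (c ⊔ ℓ) where
  _≅_ : M → M → Set ℓ
  x ≅ y = (x ≼ y) × (y ≼ x)
  field
    ≼-refl  : ∀ x → x ≼ x
    ≼-trans : ∀ {x y z} → x ≼ y → y ≼ z → x ≼ z
    opcm1 : ∀ x → Σ[ p ∈ 𝟘 ⊥ x ] ((𝟘 ⊕ x) p ≅ x)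
    opcm2 : ∀ x y (p : x ⊥ y) → Σ[ q ∈ y ⊥ x ] ((x ⊕ y) p ≅ (y ⊕ x) q)
    opcm3 : ∀ x y z (p : y ⊥ z) (q : x ⊥ (y ⊕ z) p) →
            Σ[ r ∈ x ⊥ y ] Σ[ s ∈ ((x ⊕ y) r) ⊥ z ]
              ((x ⊕ (y ⊕ z) p) q ≅ ((x ⊕ y) r ⊕ z) s)
    opcm4 : ∀ x₁ x₂ y → x₁ ≼ x₂ → (p : x₁ ⊥ y) (q : x₂ ⊥ y) →
            (x₁ ⊕ y) p ≼ (x₂ ⊕ y) q

record OPCM (c ℓ : Level) : Set (suc (c ⊔ ℓ)) where
  field
    Carrier : Set c
    _≼_     : Carrier → Carrier → Set ℓ
    _⊥_     : Carrier → Carrier → Set ℓ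
    _⊕_     : (x y : Carrier) → x ⊥ y → Carrier
    𝟘       : Carrier
    isOPCM  : IsOPCM Carrier _≼_ _⊥_ _⊕_ 𝟘
  open IsOPCM isOPCM public

module PowerOPCM {c ℓ : Level} (M : OPCM c ℓ) where
  open OPCM M

  DownwardClosed : Set (c ⊔ ℓ)
  DownwardClosed = ∀ x x' y → x ≼ x' → x' ⊥ y → x ⊥ y

  Subset : Set (suc (c ⊔ ℓ))
  Subset = Carrier → Set (c ⊔ ℓ)

  ℙ⁺ : Set (suc (c ⊔ ℓ))
  ℙ⁺ = Σ[ P ∈ Subset ] Σ[ x ∈ Carrier ] P x

  sumSet : ℙ⁺ → ℙ⁺ → Subset
  sumSet (P , _) (Q , _) z =
    Σ[ x ∈ Carrier ] Σ[ y ∈ Carrier ] P x × Q y × Σ[ p ∈ x ⊥ y ] (z ≡ (x ⊕ y) p)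

  _⊥ᴾ_ : ℙ⁺ → ℙ⁺ → Set (c ⊔ ℓ)
  P ⊥ᴾ Q = Σ[ z ∈ Carrier ] sumSet P Q z

  _⊕ᴾ_ : (P Q : ℙ⁺) → P ⊥ᴾ Q → ℙ⁺
  (P ⊕ᴾ Q) ne = sumSet P Q , ne

  _≼♯_ : ℙ⁺ → ℙ⁺ → Set (c ⊔ ℓ)
  (P , _) ≼♯ (Q , _) = ∀ y → Q y → Σ[ x ∈ Carrier ] P x × (x ≼ y)

  𝟘ᴾ : ℙ⁺
  𝟘ᴾ = (λ z → Lift ℓ (z ≡ 𝟘)) , 𝟘 , Level.lift _≡_.refl

module Submission where

-- Every axiom for ℙ⁺M reduces, elementwise, to the corresponding axiom
-- for M.  The only non-routine point is associativity: an element
-- (x ⊕ y) ⊕ u of (P ⊕ Q) ⊕ R must be dominated by an element of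
-- P ⊕ (Q ⊕ R), i.e. we need the *reverse* of (OPCM3).  In a
-- ⊕-downward closed OPCM this follows from (OPCM3) and commutativity,
-- because definedness can be transported along ≼ in either argument.

open import Defs
open import Data.Product using (_×_; _,_; proj₁; proj₂; Σ-syntax)
open import Level using (_⊔_; lift)
open import Relation.Binary.PropositionalEquality using (refl)
import Relation.Binary.Reasoning.Base.Single as Single

module OPCMFacts {c ℓ} (M : OPCM c ℓ) where
  open OPCM M public

  module ≼-Reasoning = Single _≼_ (λ {x} → ≼-refl x) ≼-trans

  ⊥-sym : ∀ {x y} → x ⊥ y → y ⊥ x
  ⊥-sym {x} {y} p = proj₁ (opcm2 x y p)

  ⊕-comm : ∀ {x y} (p : x ⊥ y) → (x ⊕ y) p ≼ (y ⊕ x) (⊥-sym p)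
  ⊕-comm {x} {y} p = proj₁ (proj₂ (opcm2 x y p))

  ⊕-comm⁻ : ∀ {x y} (p : x ⊥ y) → (y ⊕ x) (⊥-sym p) ≼ (x ⊕ y) p
  ⊕-comm⁻ {x} {y} p = proj₂ (proj₂ (opcm2 x y p))

  ⊕-irrelevant : ∀ {x y} (p q : x ⊥ y) → (x ⊕ y) p ≼ (x ⊕ y) q
  ⊕-irrelevant {x} {y} = opcm4 x x y (≼-refl x)

module DownwardFacts {c ℓ} (M : OPCM c ℓ)
                     (down : PowerOPCM.DownwardClosed M) where
  open OPCMFacts M public

  ⊥-downʳ : ∀ {x a b} → a ≼ b → x ⊥ b → x ⊥ a
  ⊥-downʳ {x} {a} {b} a≼b x⊥b = ⊥-sym (down a b x a≼b (⊥-sym x⊥b))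

  ⊕-monoʳ : ∀ {x a b} → a ≼ b → (p : x ⊥ a) (q : x ⊥ b) →
            (x ⊕ a) p ≼ (x ⊕ b) q
  ⊕-monoʳ {x} {a} {b} a≼b p q = begin
    (x ⊕ a) p                  ∼⟨ ⊕-comm p ⟩
    (a ⊕ x) (⊥-sym p)          ∼⟨ opcm4 a b x a≼b (⊥-sym p) (⊥-sym q) ⟩
    (b ⊕ x) (⊥-sym q)          ∼⟨ ⊕-comm⁻ q ⟩
    (x ⊕ b) q                  ∎
    where open ≼-Reasoning

  -- Reverse associativity: if (x ⊕ y) ⊕ u is defined, so is
  -- x ⊕ (y ⊕ u), and it lies below.  Proof: rotate to u ⊕ (y ⊕ x),
  -- apply (OPCM3) and rotate back, transporting definedness along ≼.
  ⊕-assoc⁻ : ∀ {x y u} (r : x ⊥ y) (s : (x ⊕ y) r ⊥ u) →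
    Σ[ p ∈ y ⊥ u ] Σ[ q ∈ x ⊥ (y ⊕ u) p ]
      ((x ⊕ (y ⊕ u) p) q ≼ ((x ⊕ y) r ⊕ u) s)
  ⊕-assoc⁻ {x} {y} {u} r s = rotateBack (opcm3 u y x (⊥-sym r) u⊥yx)
    where
    u⊥yx : u ⊥ (y ⊕ x) (⊥-sym r)
    u⊥yx = ⊥-downʳ (⊕-comm⁻ r) (⊥-sym s)

    rotateBack :
      Σ[ u⊥y ∈ u ⊥ y ] Σ[ uy⊥x ∈ (u ⊕ y) u⊥y ⊥ x ]
        ((u ⊕ (y ⊕ x) (⊥-sym r)) u⊥yx ≅ ((u ⊕ y) u⊥y ⊕ x) uy⊥x) →
      Σ[ p ∈ y ⊥ u ] Σ[ q ∈ x ⊥ (y ⊕ u) p ]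
        ((x ⊕ (y ⊕ u) p) q ≼ ((x ⊕ y) r ⊕ u) s)
    rotateBack (u⊥y , uy⊥x , assoc) = ⊥-sym u⊥y , x⊥yu , (begin
      (x ⊕ (y ⊕ u) (⊥-sym u⊥y)) x⊥yu
        ∼⟨ ⊕-monoʳ (⊕-comm⁻ u⊥y) x⊥yu (⊥-sym uy⊥x) ⟩
      (x ⊕ (u ⊕ y) u⊥y) (⊥-sym uy⊥x)
        ∼⟨ ⊕-comm⁻ uy⊥x ⟩
      ((u ⊕ y) u⊥y ⊕ x) uy⊥x
        ∼⟨ proj₂ assoc ⟩
      (u ⊕ (y ⊕ x) (⊥-sym r)) u⊥yx
        ∼⟨ ⊕-monoʳ (⊕-comm⁻ r) u⊥yx (⊥-sym s) ⟩
      (u ⊕ (x ⊕ y) r) (⊥-sym s)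
        ∼⟨ ⊕-comm⁻ s ⟩
      ((x ⊕ y) r ⊕ u) s
        ∎)
      where
      open ≼-Reasoning

      x⊥yu : x ⊥ (y ⊕ u) (⊥-sym u⊥y)
      x⊥yu = ⊥-downʳ (⊕-comm⁻ u⊥y) (⊥-sym uy⊥x)

module PowerFacts {c ℓ} (M : OPCM c ℓ)
                  (down : PowerOPCM.DownwardClosed M) where
  open DownwardFacts M down
  open PowerOPCM M

  _∈_ : Carrier → ℙ⁺ → Set (c ⊔ ℓ)
  x ∈ P = proj₁ P x

  _≅♯_ : ℙ⁺ → ℙ⁺ → Set (c ⊔ ℓ)
  P ≅♯ Q = (P ≼♯ Q) × (Q ≼♯ P)

  ∈-sum : ∀ P Q (d : P ⊥ᴾ Q) {x y} → x ∈ P → y ∈ Q → (p : x ⊥ y) →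
          (x ⊕ y) p ∈ (P ⊕ᴾ Q) d
  ∈-sum _ _ _ x∈P y∈Q p = _ , _ , x∈P , y∈Q , p , refl

  ⊥ᴾ-intro : ∀ P Q {x y} → x ∈ P → y ∈ Q → x ⊥ y → P ⊥ᴾ Q
  ⊥ᴾ-intro _ _ x∈P y∈Q p = _ , _ , _ , x∈P , y∈Q , p , refl

  ≼♯-sum : ∀ P Q (A : ℙ⁺) (d : P ⊥ᴾ Q) →
    (∀ {x y} → x ∈ P → y ∈ Q → (p : x ⊥ y) →
       Σ[ z ∈ Carrier ] z ∈ A × z ≼ (x ⊕ y) p) →
    A ≼♯ (P ⊕ᴾ Q) d
  ≼♯-sum _ _ _ _ below _ (_ , _ , x∈P , y∈Q , p , refl) = below x∈P y∈Q p

  ≼♯-refl : ∀ P → P ≼♯ P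
  ≼♯-refl P y y∈P = y , y∈P , ≼-refl y

  ≼♯-trans : ∀ P Q R → P ≼♯ Q → Q ≼♯ R → P ≼♯ R
  ≼♯-trans _ _ _ P≼Q Q≼R z z∈R =
    let (y , y∈Q , y≼z) = Q≼R z z∈R
        (x , x∈P , x≼y) = P≼Q y y∈Q
    in x , x∈P , ≼-trans x≼y y≼z

  𝟘ᴾ-unit : ∀ P → Σ[ d ∈ 𝟘ᴾ ⊥ᴾ P ] ((𝟘ᴾ ⊕ᴾ P) d ≅♯ P)
  𝟘ᴾ-unit P@(_ , x , x∈P) = d , sum≼P , P≼sum
    where
    d : 𝟘ᴾ ⊥ᴾ P
    d = ⊥ᴾ-intro 𝟘ᴾ P (lift refl) x∈P (proj₁ (opcm1 x))

    sum≼P : (𝟘ᴾ ⊕ᴾ P) d ≼♯ P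
    sum≼P y y∈P =
      let (p , 𝟘y≅y) = opcm1 y
      in (𝟘 ⊕ y) p , ∈-sum 𝟘ᴾ P d (lift refl) y∈P p , proj₁ 𝟘y≅y

    P≼sum : P ≼♯ (𝟘ᴾ ⊕ᴾ P) d
    P≼sum = ≼♯-sum 𝟘ᴾ P P d λ { {y = y} (lift refl) y∈P p →
      let (q , 𝟘y≅y) = opcm1 y
      in y , y∈P , ≼-trans (proj₂ 𝟘y≅y) (⊕-irrelevant q p) }

  ⊥ᴾ-sym : ∀ P Q → P ⊥ᴾ Q → Q ⊥ᴾ P
  ⊥ᴾ-sym P Q (_ , _ , _ , x∈P , y∈Q , p , refl) =
    ⊥ᴾ-intro Q P y∈Q x∈P (⊥-sym p)

  sum-comm : ∀ P Q (d : P ⊥ᴾ Q) (d' : Q ⊥ᴾ P) →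
             (P ⊕ᴾ Q) d ≼♯ (Q ⊕ᴾ P) d'
  sum-comm P Q d d' = ≼♯-sum Q P ((P ⊕ᴾ Q) d) d' λ y∈Q x∈P p →
    _ , ∈-sum P Q d x∈P y∈Q (⊥-sym p) , ⊕-comm⁻ p

  sum-assoc-defined : ∀ P Q R (d : Q ⊥ᴾ R) → P ⊥ᴾ (Q ⊕ᴾ R) d →
    Σ[ r ∈ P ⊥ᴾ Q ] ((P ⊕ᴾ Q) r ⊥ᴾ R)
  sum-assoc-defined P Q R d
    (_ , x , _ , x∈P , (y , u , y∈Q , u∈R , p , refl) , q , refl) =
    let (r , s , _) = opcm3 x y u p q
        r' = ⊥ᴾ-intro P Q x∈P y∈Q r
    in r' , ⊥ᴾ-intro ((P ⊕ᴾ Q) r') R (∈-sum P Q r' x∈P y∈Q r) u∈R s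

  sum-assoc : ∀ P Q R (d : Q ⊥ᴾ R) (e : P ⊥ᴾ (Q ⊕ᴾ R) d)
    (r : P ⊥ᴾ Q) (s : (P ⊕ᴾ Q) r ⊥ᴾ R) →
    (P ⊕ᴾ (Q ⊕ᴾ R) d) e ≅♯ ((P ⊕ᴾ Q) r ⊕ᴾ R) s
  sum-assoc P Q R d e r s = leftBelow , rightBelow
    where
    leftBelow : (P ⊕ᴾ (Q ⊕ᴾ R) d) e ≼♯ ((P ⊕ᴾ Q) r ⊕ᴾ R) s
    leftBelow = ≼♯-sum ((P ⊕ᴾ Q) r) R ((P ⊕ᴾ (Q ⊕ᴾ R) d) e) s λ
      { (_ , _ , x∈P , y∈Q , xy , refl) u∈R xyu →
          let (yu , x[yu] , le) = ⊕-assoc⁻ xy xyu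
          in _ , ∈-sum P ((Q ⊕ᴾ R) d) e x∈P (∈-sum Q R d y∈Q u∈R yu) x[yu] , le }

    rightBelow : ((P ⊕ᴾ Q) r ⊕ᴾ R) s ≼♯ (P ⊕ᴾ (Q ⊕ᴾ R) d) e
    rightBelow = ≼♯-sum P ((Q ⊕ᴾ R) d) (((P ⊕ᴾ Q) r ⊕ᴾ R) s) e λ
      { {x} x∈P (_ , _ , y∈Q , u∈R , yu , refl) x[yu] →
          let (xy , xyu , assoc) = opcm3 x _ _ yu x[yu]
          in _ , ∈-sum ((P ⊕ᴾ Q) r) R s (∈-sum P Q r x∈P y∈Q xy) u∈R xyu , proj₂ assoc }

  -- (OPCM4) for ℙ⁺M; downward closure makes the smaller sum defined.
  sum-monoˡ : ∀ P₁ P₂ Q → P₁ ≼♯ P₂ → (d₁ : P₁ ⊥ᴾ Q) (d₂ : P₂ ⊥ᴾ Q) →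
              (P₁ ⊕ᴾ Q) d₁ ≼♯ (P₂ ⊕ᴾ Q) d₂
  sum-monoˡ P₁ P₂ Q P₁≼P₂ d₁ d₂ = ≼♯-sum P₂ Q ((P₁ ⊕ᴾ Q) d₁) d₂ λ {x₂} {y} x₂∈P₂ y∈Q p →
    let (x₁ , x₁∈P₁ , x₁≼x₂) = P₁≼P₂ x₂ x₂∈P₂
        p₁ = down x₁ x₂ y x₁≼x₂ p
    in _ , ∈-sum P₁ Q d₁ x₁∈P₁ y∈Q p₁ , opcm4 x₁ x₂ y x₁≼x₂ p₁ p

  powerIsOPCM : IsOPCM ℙ⁺ _≼♯_ _⊥ᴾ_ _⊕ᴾ_ 𝟘ᴾ
  powerIsOPCM = record
    { ≼-refl  = ≼♯-refl
    ; ≼-trans = λ {P} {Q} {R} → ≼♯-trans P Q R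
    ; opcm1   = 𝟘ᴾ-unit
    ; opcm2   = λ P Q d → let d' = ⊥ᴾ-sym P Q d in
                  d' , sum-comm P Q d d' , sum-comm Q P d' d
    ; opcm3   = λ P Q R d e → let (r , s) = sum-assoc-defined P Q R d e in
                  r , s , sum-assoc P Q R d e r s
    ; opcm4   = sum-monoˡ
    }

  𝟘ᴾ-least : (∀ x → 𝟘 ≼ x) → ∀ P → 𝟘ᴾ ≼♯ P
  𝟘ᴾ-least 𝟘-least P y _ = 𝟘 , lift refl , 𝟘-least y

mainTheorem3 : ∀ {c ℓ} (M : OPCM c ℓ) → PowerOPCM.DownwardClosed M →
    IsOPCM (PowerOPCM.ℙ⁺ M) (PowerOPCM._≼♯_ M) (PowerOPCM._⊥ᴾ_ M) (PowerOPCM._⊕ᴾ_ M) (PowerOPCM.𝟘ᴾ M)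
    × ((∀ x → OPCM._≼_ M (OPCM.𝟘 M) x) → ∀ P → PowerOPCM._≼♯_ M (PowerOPCM.𝟘ᴾ M) P)
mainTheorem3 M down = powerIsOPCM , 𝟘ᴾ-least
  where open PowerFacts M down
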